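{- Let $k\ge1$ and let $M$ be the $k\times k$ array whose entry $M_{i,j}$ (row $i$, column $j$, $1\le i,j\le k$) has value $i$. Let $\omega$ be the sequence of length $k^2$ obtained by concatenating, for $d=2,3,\dots,2k$ in this order, the entries $M_{i,j}$ with $i+j=d$ listed in decreasing order of $i$ (e.g. $\omega=(1,2,1,3,2,1,3,2,3)$ for $k=3$). For $1-k\le x\le k-1$ let $D_x$ be the subsequence of $\omega$ consisting of the entries $M_{i,j}$ with $j=i+x$, listed in increasing order of $i$. Then the greedy algorithm for the $k$-LIS problem on $\omega$ may (for a suitable choice among longest increasing subsequences at each step) return $A_1=D_0$, $A_{2i}=D_i$, $A_{2i+1}=D_{ -i}$ (for the indices $\le k$), i.e. the $k$ longest of the diagonals $D_{1-k},\dots,D_{k-1}$, with total length $|A_1|+\cdots+|A_k|=\lceil\tfrac34k^2\rceil$.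
   Context: The $k$-LIS problem: given a sequence $\omega$, find $k$ pairwise disjoint (position-disjoint) increasing subsequences of $\omega$ maximizing their total length. The greedy algorithm: for $i=1,\dots,k$, choose a longest increasing subsequence $A_i$ of the current sequence (any one if several), output it, and remove its elements from the sequence. Each $D_x$ is a strictly increasing subsequence of $\omega$ of length $k-|x|$. -}

module Defs where

open import Data.Nat using (ℕ; zero; suc; _+_; _*_; _∸_; _≤_; _<_; _≤?_; _<?_; _/_; _%_)
open import Data.Integer as ℤ using (ℤ; +_; -[1+_]; -_)
open import Data.Fin as Fin using (Fin)
open import Data.Product using (Σ; _×_; _,_; proj₁; proj₂)
open import Data.Unit using (⊤)
open import Data.List using (List; []; _∷_; _++_; map; filter; concatMap; upTo; downFrom; length; lookup; sum)
open import Data.List.Properties using (length-map)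
open import Data.List.Membership.Propositional using (_∉_)
open import Data.List.Relation.Unary.All using (All)
open import Data.List.Relation.Unary.Linked using (Linked)
open import Relation.Nullary using (¬_)
open import Relation.Binary.PropositionalEquality using (_≡_)
open import Relation.Nullary.Decidable using (_×-dec_)

-- Generic k-LIS notions for a finite sequence s : List ℕ.
-- A subsequence is given by its list of positions (indices into s).

Pos : List ℕ → Set
Pos s = Fin (length s)

IncSub : (s : List ℕ) → (Pos s → Set) → List (Pos s) → Set
IncSub s avail ps =
  Linked (λ p q → (p Fin.< q) × (lookup s p < lookup s q)) ps × All avail ps

LongestIncSub : (s : List ℕ) → (Pos s → Set) → List (Pos s) → Set
LongestIncSub s avail ps =
  IncSub s avail ps × (∀ qs → IncSub s avail qs → length qs ≤ length ps)

GreedyFrom : (s : List ℕ) → List (Pos s) → List (List (Pos s)) → Set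
GreedyFrom s used []       = ⊤
GreedyFrom s used (A ∷ As) =
  LongestIncSub s (λ p → p ∉ used) A × GreedyFrom s (used ++ A) As

GreedyRun : (s : List ℕ) → ℕ → List (List (Pos s)) → Set
GreedyRun s k As = (length As ≡ k) × GreedyFrom s [] As

Cell : Set
Cell = ℕ × ℕ     -- (i , j) = row i, column j  (1-based)

oneTo : ℕ → List ℕ
oneTo k = map suc (upTo k)

toOne : ℕ → List ℕ
toOne k = map suc (downFrom k)

antiDiag : ℕ → ℕ → List Cell
antiDiag k d = map (λ i → (i , d ∸ i))
                   (filter (λ i → (i <? d) ×-dec (d ∸ i ≤? k)) (toOne k))

cells : ℕ → List Cell
cells k = concatMap (antiDiag k) (map (_+ 2) (upTo (2 * k ∸ 1)))

-- the value of M_{i,j} is i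
ω : ℕ → List ℕ
ω k = map proj₁ (cells k)

cellAt : (k : ℕ) → Pos (ω k) → Cell
cellAt k p = lookup (cells k) (Fin.cast (length-map proj₁ (cells k)) p)

-- Diagonals, as lists of entries in increasing order of i.
-- D⁺ y : entries (i , i + y);  D⁻ y : entries (i , i - y) (i.e. (i' + y , i')).
D⁺ : ℕ → ℕ → List Cell
D⁺ k y = map (λ i → (i , i + y)) (filter (λ i → i + y ≤? k) (oneTo k))

D⁻ : ℕ → ℕ → List Cell
D⁻ k y = map (λ i → (i + y , i)) (filter (λ i → i + y ≤? k) (oneTo k))

D : ℕ → ℤ → List Cell
D k (+ y)     = D⁺ k y
D k -[1+ y ]  = D⁻ k (suc y)

-- index of the diagonal prescribed for A_m (m ≥ 1):
-- A₁ = D₀, A_{2i} = D_i, A_{2i+1} = D_{-i}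
diagIndex : ℕ → ℤ
diagIndex m with m % 2
... | 0 = + (m / 2)
... | _ = - (+ (m / 2))

ceil3k²/4 : ℕ → ℕ
ceil3k²/4 k = (3 * (k * k) + 3) / 4

-- Order the diagonals as the greedy run takes them, D₀, D₁, D₋₁, D₂, D₋₂, …;
-- the m-th of them (counting from 0) lies at distance ⌈m/2⌉ from the main
-- diagonal, and once the first m are removed every remaining entry (i , j)
-- has |j − i| ≥ s = ⌈m/2⌉. Along an increasing subsequence of ω both the row
-- i and the anti-diagonal i + j strictly increase, so the folded row (i above
-- the main diagonal, i − s below it) strictly increases and stays within
-- 1 … k − s. Hence no increasing subsequence of what remains is longer than
-- k − s, the length of the next diagonal. The lengths add up to
-- Σ_{m<k} (k − ⌈m/2⌉) = k² − ⌊k/2⌋⌈k/2⌉ = ⌈3k²/4⌉.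

module Submission where

open import Defs
open import Data.Nat using (ℕ; zero; suc; _+_; _*_; _∸_; _⊓_; _%_; s≤s⁻¹; _≤_; _<_; _>_; _≤?_; _<?_; z≤n; s≤s; ⌊_/2⌋; ⌈_/2⌉; NonZero; _/_)
open import Data.Nat.Properties
open import Data.Nat.DivMod using (+-distrib-/-∣ʳ; m<n⇒m/n≡0; m*n/n≡m; m*n%n≡0; [m+kn]%n≡m%n)
open import Data.Nat.Divisibility using (divides-refl)
open import Data.Nat.ListAction using (sum)
open import Data.Nat.ListAction.Properties using (sum-++)
open import Data.Nat.Tactic.RingSolver using (solve-∀)
open import Data.Integer as ℤ using (ℤ; -[1+_]; -_; _⊖_; ∣_∣)
open import Data.Integer.Properties using (⊖-≥; ⊖-<)
open import Data.Fin as Fin using (Fin; toℕ; fromℕ<; cast)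
open import Data.Fin.Properties using (toℕ-fromℕ<; toℕ-cast)
import Data.Fin.Properties as Fin
open import Data.List using (List; []; _∷_; _++_; [_]; map; filter; length; lookup; upTo; applyUpTo; tabulate; allFin)
open import Data.List.Properties using (length-map; length-upTo; length-applyUpTo; lookup-applyUpTo; applyUpTo-∷ʳ; map-applyUpTo; map-tabulate)
open import Data.List.Membership.Propositional using (_∈_; _∉_; lose)
open import Data.List.Membership.Propositional.Properties
open import Data.List.Relation.Binary.Subset.Propositional using (_⊆_)
open import Data.List.Relation.Unary.Any using (here; there)
import Data.List.Relation.Unary.Any as Any
open import Data.List.Relation.Unary.All as All using (All; []; _∷_)
import Data.List.Relation.Unary.All.Properties as All
open import Data.List.Relation.Unary.AllPairs as AllPairs using (AllPairs; []; _∷_)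
import Data.List.Relation.Unary.AllPairs.Properties as AllPairs
open import Data.List.Relation.Unary.Linked using (Linked)
import Data.List.Relation.Unary.Linked.Properties as Linked
open import Data.Product using (Σ; ∃; _×_; _,_; proj₁; proj₂)
open import Data.Sum using (_⊎_; inj₁; inj₂)
open import Data.Unit using (tt)
open import Data.Empty using (⊥-elim)
open import Function using (_∘_; id; _on_; _⇔_; mk⇔; Equivalence)
open import Relation.Nullary using (yes; no)
open import Relation.Nullary.Decidable using (_×-dec_)
open import Relation.Unary using (Decidable)
open import Relation.Binary using (Rel; Irreflexive; Asymmetric; Transitive)
open import Level using (0ℓ)
open import Relation.Binary.PropositionalEquality using (_≡_; refl; sym; trans; cong; cong₂; subst; subst₂; module ≡-Reasoning)

private
  variable
    A B : Set

-- Sorted lists and sums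

AllPairs-lookup : ∀ {R : Rel A 0ℓ} {xs} → AllPairs R xs →
                  ∀ {i j} → i Fin.< j → R (lookup xs i) (lookup xs j)
AllPairs-lookup (r ∷ _)  {Fin.zero}  {Fin.suc j} _         = All.lookup r (∈-lookup j)
AllPairs-lookup (_ ∷ rs) {Fin.suc i} {Fin.suc j} (s≤s i<j) = AllPairs-lookup rs i<j

AllPairs-restrict : ∀ {P : A → Set} {R S : Rel A 0ℓ} {xs} →
                    (∀ {x y} → P x → P y → R x y → S x y) →
                    All P xs → AllPairs R xs → AllPairs S xs
AllPairs-restrict f []         []       = []
AllPairs-restrict f (px ∷ pxs) (r ∷ rs) =
  All.zipWith (λ (py , rxy) → f px py rxy) (pxs , r) ∷ AllPairs-restrict f pxs rs

strictlySorted-⊆-antisym : ∀ {R : Rel A 0ℓ} → Irreflexive _≡_ R → Asymmetric R →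
                           ∀ {xs ys} → AllPairs R xs → AllPairs R ys →
                           xs ⊆ ys → ys ⊆ xs → xs ≡ ys
strictlySorted-⊆-antisym irr asym {[]}    {[]}    _ _ _ _ = refl
strictlySorted-⊆-antisym irr asym {[]}    {_ ∷ _} _ _ _ ys⊆xs with ys⊆xs (here refl)
... | ()
strictlySorted-⊆-antisym irr asym {_ ∷ _} {[]}    _ _ xs⊆ys _ with xs⊆ys (here refl)
... | ()
strictlySorted-⊆-antisym {R = R} irr asym {x ∷ xs} {y ∷ ys} (x< ∷ sxs) (y< ∷ sys) xs⊆ys ys⊆xs
  with xs⊆ys (here refl) | ys⊆xs (here refl)
... | here refl   | _           =
  cong (x ∷_) (strictlySorted-⊆-antisym irr asym sxs sys
                 (drop-head x< (xs⊆ys ∘ there)) (drop-head y< (ys⊆xs ∘ there)))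
  where
  drop-head : ∀ {z zs us} → All (R z) zs → zs ⊆ z ∷ us → zs ⊆ us
  drop-head z< zs⊆ u∈ with zs⊆ u∈
  ... | here refl  = ⊥-elim (irr refl (All.lookup z< u∈))
  ... | there u∈us = u∈us
... | there x∈ys | here refl  = ⊥-elim (irr refl (All.lookup y< x∈ys))
... | there x∈ys | there y∈xs = ⊥-elim (asym (All.lookup x< y∈xs) (All.lookup y< x∈ys))

AllPairs-<-length≤ : ∀ {a b xs} → AllPairs _<_ xs → All (λ x → a < x × x ≤ b) xs →
                     length xs ≤ b ∸ a
AllPairs-<-length≤ []                []                         = z≤n
AllPairs-<-length≤ (x< ∷ increasing) ((a<x , x≤b) ∷ bounds) =
  ≤-trans (s≤s (AllPairs-<-length≤ increasing bounds′)) (∸-monoʳ-< a<x x≤b)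
  where bounds′ = All.zipWith (λ (x<y , (_ , y≤b)) → x<y , y≤b) (x< , bounds)

lookup-map-cast : ∀ (f : A → B) xs i → lookup (map f xs) i ≡ f (lookup xs (cast (length-map f xs) i))
lookup-map-cast f (x ∷ xs) Fin.zero    = refl
lookup-map-cast f (x ∷ xs) (Fin.suc i) = lookup-map-cast f xs i

tabulate-lookup-cast : ∀ (f : A → B) xs → tabulate (lookup xs ∘ cast (length-map f xs)) ≡ xs
tabulate-lookup-cast f []       = refl
tabulate-lookup-cast f (x ∷ xs) = cong (x ∷_) (tabulate-lookup-cast f xs)

map-filter : ∀ (f : A → B) {P : B → Set} (P? : Decidable P) xs →
             map f (filter (P? ∘ f) xs) ≡ filter P? (map f xs)
map-filter f P? []       = refl
map-filter f P? (x ∷ xs) with P? (f x)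
... | yes _ = cong (f x ∷_) (map-filter f P? xs)
... | no  _ = map-filter f P? xs

sum-applyUpTo-suc : ∀ (f : ℕ → ℕ) n → sum (applyUpTo f (suc n)) ≡ sum (applyUpTo f n) + f n
sum-applyUpTo-suc f n = begin
  sum (applyUpTo f (suc n))          ≡⟨ cong sum (applyUpTo-∷ʳ f n) ⟨
  sum (applyUpTo f n ++ [ f n ])     ≡⟨ sum-++ (applyUpTo f n) [ f n ] ⟩
  sum (applyUpTo f n) + (f n + 0)    ≡⟨ cong (sum (applyUpTo f n) +_) (+-identityʳ (f n)) ⟩
  sum (applyUpTo f n) + f n          ∎
  where open ≡-Reasoning

sum-applyUpTo-complement : ∀ {c} n (f g : ℕ → ℕ) → (∀ r → r < n → f r + g r ≡ c) →
                           sum (applyUpTo f n) + sum (applyUpTo g n) ≡ n * c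
sum-applyUpTo-complement zero    f g fg≡c = refl
sum-applyUpTo-complement {c} (suc n) f g fg≡c = begin
  (f 0 + F) + (g 0 + G)  ≡⟨ interchange (f 0) F (g 0) G ⟩
  (f 0 + g 0) + (F + G)  ≡⟨ cong₂ _+_ (fg≡c 0 (s≤s z≤n)) (sum-applyUpTo-complement n (f ∘ suc) (g ∘ suc) fg≡c′) ⟩
  suc n * c              ∎
  where
  open ≡-Reasoning
  F = sum (applyUpTo (f ∘ suc) n)
  G = sum (applyUpTo (g ∘ suc) n)
  fg≡c′ : ∀ r → r < n → f (suc r) + g (suc r) ≡ c
  fg≡c′ r r<n = fg≡c (suc r) (s≤s r<n)
  interchange : ∀ a b c d → (a + b) + (c + d) ≡ (a + c) + (b + d)
  interchange = solve-∀

⌊n*2/2⌋≡n : ∀ n → ⌊ n * 2 /2⌋ ≡ n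
⌊n*2/2⌋≡n zero    = refl
⌊n*2/2⌋≡n (suc n) = cong suc (⌊n*2/2⌋≡n n)

⌈n*2/2⌉≡n : ∀ n → ⌈ n * 2 /2⌉ ≡ n
⌈n*2/2⌉≡n zero    = refl
⌈n*2/2⌉≡n (suc n) = cong suc (⌈n*2/2⌉≡n n)

sum-applyUpTo-⌈/2⌉ : ∀ n → sum (applyUpTo ⌈_/2⌉ n) ≡ ⌊ n /2⌋ * ⌈ n /2⌉
sum-applyUpTo-⌈/2⌉ zero    = refl
sum-applyUpTo-⌈/2⌉ (suc n) = begin
  sum (applyUpTo ⌈_/2⌉ (suc n))       ≡⟨ sum-applyUpTo-suc ⌈_/2⌉ n ⟩
  sum (applyUpTo ⌈_/2⌉ n) + ⌈ n /2⌉   ≡⟨ cong (_+ ⌈ n /2⌉) (sum-applyUpTo-⌈/2⌉ n) ⟩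
  ⌊ n /2⌋ * ⌈ n /2⌉ + ⌈ n /2⌉         ≡⟨ step ⌊ n /2⌋ ⌈ n /2⌉ ⟩
  ⌈ n /2⌉ * suc ⌊ n /2⌋               ∎
  where
  open ≡-Reasoning
  step : ∀ a b → a * b + b ≡ b * suc a
  step = solve-∀

[m+n*d]/d≡n : ∀ {m n d} .{{_ : NonZero d}} → m < d → (m + n * d) / d ≡ n
[m+n*d]/d≡n {m} {n} {d} m<d =
  trans (+-distrib-/-∣ʳ m (divides-refl n)) (cong₂ _+_ (m<n⇒m/n≡0 m<d) (m*n/n≡m n d))

even⊎odd : ∀ n → ∃ λ u → n ≡ u + u ⊎ n ≡ suc (u + u)
even⊎odd zero = 0 , inj₁ refl
even⊎odd (suc n) with even⊎odd n
... | u , inj₁ refl = u , inj₂ refl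
... | u , inj₂ refl = suc u , inj₁ (cong suc (sym (+-suc u u)))

ceil3k²/4+⌊k/2⌋*⌈k/2⌉≡k*k : ∀ k → ceil3k²/4 k + ⌊ k /2⌋ * ⌈ k /2⌉ ≡ k * k
ceil3k²/4+⌊k/2⌋*⌈k/2⌉≡k*k k with even⊎odd k
... | u , inj₁ refl = begin
  (3 * ((u + u) * (u + u)) + 3) / 4 + ⌊ u + u /2⌋ * ⌈ u + u /2⌉
    ≡⟨ cong₂ _+_ (trans (cong (_/ 4) (numerator u)) ([m+n*d]/d≡n {3} (s≤s (s≤s (s≤s (s≤s z≤n))))))
                 (sym (cong₂ _*_ (n≡⌊n+n/2⌋ u) (n≡⌈n+n/2⌉ u))) ⟩
  3 * (u * u) + u * u
    ≡⟨ square u ⟩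
  (u + u) * (u + u) ∎
  where
  open ≡-Reasoning
  numerator : ∀ u → 3 * ((u + u) * (u + u)) + 3 ≡ 3 + 3 * (u * u) * 4
  numerator = solve-∀
  square : ∀ u → 3 * (u * u) + u * u ≡ (u + u) * (u + u)
  square = solve-∀
... | u , inj₂ refl = begin
  (3 * (suc (u + u) * suc (u + u)) + 3) / 4 + ⌊ suc (u + u) /2⌋ * ⌈ suc (u + u) /2⌉
    ≡⟨ cong₂ _+_ (trans (cong (_/ 4) (numerator u)) ([m+n*d]/d≡n {2} (s≤s (s≤s (s≤s z≤n)))))
                 (sym (cong₂ _*_ (n≡⌈n+n/2⌉ u) (cong suc (n≡⌊n+n/2⌋ u)))) ⟩
  (3 * (u * u) + 3 * u + 1) + u * suc u
    ≡⟨ square u ⟩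
  suc (u + u) * suc (u + u) ∎
  where
  open ≡-Reasoning
  numerator : ∀ u → 3 * (suc (u + u) * suc (u + u)) + 3 ≡ 2 + (3 * (u * u) + 3 * u + 1) * 4
  numerator = solve-∀
  square : ∀ u → (3 * (u * u) + 3 * u + 1) + u * suc u ≡ suc (u + u) * suc (u + u)
  square = solve-∀

-- The grid and the order of ω

row : Cell → ℕ
row = proj₁

antidiagonalOf : Cell → ℕ
antidiagonalOf (i , j) = i + j

InGrid : ℕ → Cell → Set
InGrid k (i , j) = (1 ≤ i × i ≤ k) × (1 ≤ j × j ≤ k)

-- the order in which ω lists the cells
_≺_ : Rel Cell 0ℓ
c ≺ c′ = antidiagonalOf c < antidiagonalOf c′ ⊎ (antidiagonalOf c ≡ antidiagonalOf c′ × row c′ < row c)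

≺-irrefl : Irreflexive _≡_ _≺_
≺-irrefl refl (inj₁ s<s)       = <-irrefl refl s<s
≺-irrefl refl (inj₂ (_ , r<r)) = <-irrefl refl r<r

≺-asym : Asymmetric _≺_
≺-asym (inj₁ s<s′)       (inj₁ s′<s)       = <-asym s<s′ s′<s
≺-asym (inj₁ s<s′)       (inj₂ (s′≡s , _)) = <-irrefl (sym s′≡s) s<s′
≺-asym (inj₂ (s≡s′ , _)) (inj₁ s′<s)       = <-irrefl (sym s≡s′) s′<s
≺-asym (inj₂ (_ , r′<r)) (inj₂ (_ , r<r′)) = <-asym r′<r r<r′

_⊏_ : Rel Cell 0ℓ
c ⊏ c′ = row c < row c′ × antidiagonalOf c < antidiagonalOf c′

≺∧row<⇒⊏ : ∀ {c c′} → c ≺ c′ → row c < row c′ → c ⊏ c′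
≺∧row<⇒⊏ (inj₁ antidiagonal<) row< = row< , antidiagonal<
≺∧row<⇒⊏ (inj₂ (_ , row>))    row< = ⊥-elim (<-asym row> row<)

∈-oneTo⁻ : ∀ {i k} → i ∈ oneTo k → 1 ≤ i × i ≤ k
∈-oneTo⁻ i∈ with ∈-map⁻ suc i∈
... | _ , x∈ , refl = s≤s z≤n , ∈-upTo⁻ x∈

∈-oneTo⁺ : ∀ {i k} → 1 ≤ i → i ≤ k → i ∈ oneTo k
∈-oneTo⁺ {suc i} _ i<k = ∈-map⁺ suc (∈-upTo⁺ i<k)

∈-toOne⁻ : ∀ {i k} → i ∈ toOne k → 1 ≤ i × i ≤ k
∈-toOne⁻ i∈ with ∈-map⁻ suc i∈
... | _ , x∈ , refl = s≤s z≤n , ∈-downFrom⁻ x∈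

∈-toOne⁺ : ∀ {i k} → 1 ≤ i → i ≤ k → i ∈ toOne k
∈-toOne⁺ {suc i} _ i<k = ∈-map⁺ suc (∈-downFrom⁺ i<k)

oneTo-sorted : ∀ k → AllPairs _<_ (oneTo k)
oneTo-sorted k = AllPairs.map⁺ (AllPairs.applyUpTo⁺₁ id k (λ i<j _ → s≤s i<j))

toOne-sorted : ∀ k → AllPairs _>_ (toOne k)
toOne-sorted k = AllPairs.map⁺ (AllPairs.applyDownFrom⁺₁ id k (λ j<i _ → s≤s j<i))

antidiagonalIndices : ℕ → List ℕ
antidiagonalIndices k = map (_+ 2) (upTo (2 * k ∸ 1))

antidiagonalIndices-sorted : ∀ k → AllPairs _<_ (antidiagonalIndices k)
antidiagonalIndices-sorted k = AllPairs.map⁺ (AllPairs.applyUpTo⁺₁ id _ (λ i<j _ → +-monoˡ-< 2 i<j))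

∈-antidiagonalIndices : ∀ {i j k} → suc i ≤ k → suc j ≤ k → suc i + suc j ∈ antidiagonalIndices k
∈-antidiagonalIndices {i} {j} {k} i<k j<k =
  subst (_∈ antidiagonalIndices k) (shift i j) (∈-map⁺ (_+ 2) (∈-upTo⁺ (m+n≤o⇒m≤o∸n (suc (i + j)) bound)))
  where
  open ≤-Reasoning
  shift : ∀ i j → i + j + 2 ≡ suc i + suc j
  shift = solve-∀
  shift′ : ∀ i j → suc (i + j) + 1 ≡ suc i + suc j
  shift′ = solve-∀
  bound : suc (i + j) + 1 ≤ 2 * k
  bound = begin
    suc (i + j) + 1  ≡⟨ shift′ i j ⟩
    suc i + suc j    ≤⟨ +-mono-≤ i<k j<k ⟩
    k + k            ≡⟨ cong (k +_) (+-identityʳ k) ⟨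
    2 * k            ∎

antiDiag-antidiagonal : ∀ k d → All (λ c → antidiagonalOf c ≡ d) (antiDiag k d)
antiDiag-antidiagonal k d =
  All.map⁺ (All.map (λ (i<d , _) → m+[n∸m]≡n (<⇒≤ i<d)) (All.all-filter _ (toOne k)))

antiDiag-sorted : ∀ k d → AllPairs _≺_ (antiDiag k d)
antiDiag-sorted k d = AllPairs.map⁺ (AllPairs-restrict same-antidiagonal
  (All.all-filter _ (toOne k)) (AllPairs.filter⁺ _ (toOne-sorted k)))
  where
  same-antidiagonal : ∀ {i i′} → i < d × d ∸ i ≤ k → i′ < d × d ∸ i′ ≤ k → i′ < i →
                      (i , d ∸ i) ≺ (i′ , d ∸ i′)
  same-antidiagonal (i<d , _) (i′<d , _) i′<i =
    inj₂ (trans (m+[n∸m]≡n (<⇒≤ i<d)) (sym (m+[n∸m]≡n (<⇒≤ i′<d))) , i′<i)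

cells-sorted : ∀ k → AllPairs _≺_ (cells k)
cells-sorted k = AllPairs.concat⁺ (All.map⁺ (All.tabulate (λ {d} _ → antiDiag-sorted k d)))
  (AllPairs.map⁺ (AllPairs.map earlier (antidiagonalIndices-sorted k)))
  where
  earlier : ∀ {d d′} → d < d′ → All (λ c → All (c ≺_) (antiDiag k d′)) (antiDiag k d)
  earlier {d} {d′} d<d′ = All.map (λ c≡d → All.map (λ c′≡d′ → inj₁ (subst₂ _<_ (sym c≡d) (sym c′≡d′) d<d′))
                                                    (antiDiag-antidiagonal k d′))
                                  (antiDiag-antidiagonal k d)

∈-cells⁻ : ∀ {k c} → c ∈ cells k → InGrid k c
∈-cells⁻ {k} c∈ with Any.satisfied (∈-concatMap⁻ (antiDiag k) {xs = antidiagonalIndices k} c∈)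
... | d , c∈antiDiag
    with ∈-map∘filter⁻ (λ i → (i , d ∸ i)) (λ i → (i <? d) ×-dec (d ∸ i ≤? k)) {xs = toOne k} c∈antiDiag
... | i , i∈ , refl , (i<d , j≤k) = ∈-toOne⁻ i∈ , (m<n⇒0<n∸m i<d , j≤k)

∈-cells⁺ : ∀ {k c} → InGrid k c → c ∈ cells k
∈-cells⁺ {k} {suc i , suc j} ((_ , i<k) , (_ , j<k)) =
  ∈-concatMap⁺ (antiDiag k) (lose (∈-antidiagonalIndices i<k j<k) c∈antiDiag)
  where
  d = suc i + suc j
  c∈antiDiag : (suc i , suc j) ∈ antiDiag k d
  c∈antiDiag = subst (λ j′ → (suc i , j′) ∈ antiDiag k d) (m+n∸m≡n (suc i) (suc j))
    (∈-map∘filter⁺ (λ i → (i , d ∸ i)) (λ i → (i <? d) ×-dec (d ∸ i ≤? k))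
      (suc i , ∈-toOne⁺ (s≤s z≤n) i<k , refl ,
       (m<m+n (suc i) (s≤s z≤n) , subst (_≤ k) (sym (m+n∸m≡n (suc i) (suc j))) j<k)))

-- Diagonals

diagonalOf : Cell → ℤ
diagonalOf (i , j) = j ⊖ i

OnDiagonal : ℤ → Cell → Set
OnDiagonal (ℤ.+ y)  (i , j) = j ≡ i + y
OnDiagonal -[1+ y ] (i , j) = i ≡ j + suc y

onDiagonal⇒diagonalOf : ∀ x c → OnDiagonal x c → diagonalOf c ≡ x
onDiagonal⇒diagonalOf (ℤ.+ y)  (i , _) refl = trans (⊖-≥ (m≤m+n i y)) (cong ℤ.+_ (m+n∸m≡n i y))
onDiagonal⇒diagonalOf -[1+ y ] (_ , j) refl =
  trans (⊖-< (m<m+n j (s≤s z≤n))) (cong (λ n → - ℤ.+ n) (m+n∸m≡n j (suc y)))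

onDiagonal-diagonalOf : ∀ c → OnDiagonal (diagonalOf c) c
onDiagonal-diagonalOf c = subst (λ x → OnDiagonal x c) (sym (onDiagonal⇒diagonalOf _ c on)) on
  where
  some-diagonal : ∀ c → ∃ λ x → OnDiagonal x c
  some-diagonal (i , j) with i ≤? j
  ... | yes i≤j = ℤ.+ (j ∸ i) , sym (m+[n∸m]≡n i≤j)
  ... | no  i≰j = -[1+ i ∸ suc j ] , sym (trans (+-suc j (i ∸ suc j)) (m+[n∸m]≡n (≰⇒> i≰j)))
  on = proj₂ (some-diagonal c)

∈-D⇒onDiagonal : ∀ {k c} x → c ∈ D k x → InGrid k c × OnDiagonal x c
∈-D⇒onDiagonal {k} (ℤ.+ y) c∈ with i , i∈ , refl , j≤k ←
  ∈-map∘filter⁻ (λ i → (i , i + y)) (λ i → i + y ≤? k) {xs = oneTo k} c∈ =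
  let 1≤i , i≤k = ∈-oneTo⁻ i∈ in ((1≤i , i≤k) , (≤-trans 1≤i (m≤m+n i y) , j≤k)) , refl
∈-D⇒onDiagonal {k} -[1+ y ] c∈ with j , j∈ , refl , i≤k ←
  ∈-map∘filter⁻ (λ j → (j + suc y , j)) (λ j → j + suc y ≤? k) {xs = oneTo k} c∈ =
  let 1≤j , j≤k = ∈-oneTo⁻ j∈ in ((≤-trans 1≤j (m≤m+n j (suc y)) , i≤k) , (1≤j , j≤k)) , refl

∈-D⁻ : ∀ {k c} x → c ∈ D k x → InGrid k c × diagonalOf c ≡ x
∈-D⁻ {c = c} x c∈ with grid , on ← ∈-D⇒onDiagonal x c∈ = grid , onDiagonal⇒diagonalOf x c on

∈-D⁺ : ∀ {k c} x → InGrid k c → diagonalOf c ≡ x → c ∈ D k x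
∈-D⁺ {k} {c} x grid refl = D-on (diagonalOf c) grid (onDiagonal-diagonalOf c)
  where
  D-on : ∀ {c} x → InGrid k c → OnDiagonal x c → c ∈ D k x
  D-on (ℤ.+ y)  ((1≤i , i≤k) , (_ , j≤k)) refl =
    ∈-map∘filter⁺ (λ i → (i , i + y)) (λ i → i + y ≤? k) (_ , ∈-oneTo⁺ 1≤i i≤k , refl , j≤k)
  D-on -[1+ y ] ((_ , i≤k) , (1≤j , j≤k)) refl =
    ∈-map∘filter⁺ (λ j → (j + suc y , j)) (λ j → j + suc y ≤? k) (_ , ∈-oneTo⁺ 1≤j j≤k , refl , i≤k)

D-sorted : ∀ k x → AllPairs _⊏_ (D k x)
D-sorted k (ℤ.+ y)  = AllPairs.map⁺ (AllPairs.filter⁺ _ (AllPairs.map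
  (λ i<i′ → i<i′ , +-mono-< i<i′ (+-monoˡ-< y i<i′)) (oneTo-sorted k)))
D-sorted k -[1+ y ] = AllPairs.map⁺ (AllPairs.filter⁺ _ (AllPairs.map
  (λ j<j′ → +-monoˡ-< (suc y) j<j′ , +-mono-< (+-monoˡ-< (suc y) j<j′) j<j′) (oneTo-sorted k)))

filter-oneTo : ∀ k y → filter (λ i → i + y ≤? k) (oneTo k) ≡ oneTo (k ∸ y)
filter-oneTo k y = strictlySorted-⊆-antisym <-irrefl <-asym
  (AllPairs.filter⁺ _ (oneTo-sorted k)) (oneTo-sorted (k ∸ y)) ⊆-oneTo ⊇-oneTo
  where
  ⊆-oneTo : filter (λ i → i + y ≤? k) (oneTo k) ⊆ oneTo (k ∸ y)
  ⊆-oneTo {i} i∈ with i∈oneTo , i+y≤k ← ∈-filter⁻ (λ i → i + y ≤? k) {xs = oneTo k} i∈ =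
    ∈-oneTo⁺ (proj₁ (∈-oneTo⁻ i∈oneTo)) (m+n≤o⇒m≤o∸n i i+y≤k)
  ⊇-oneTo : oneTo (k ∸ y) ⊆ filter (λ i → i + y ≤? k) (oneTo k)
  ⊇-oneTo {i} i∈ with 1≤i , i≤k∸y ← ∈-oneTo⁻ i∈ =
    ∈-filter⁺ (λ i → i + y ≤? k) (∈-oneTo⁺ 1≤i (≤-trans i≤k∸y (m∸n≤m k y))) (m≤o∸n⇒m+n≤o i y≤k i≤k∸y)
    where
    y≤k : y ≤ k
    y≤k = <⇒≤ (m∸n≢0⇒n<m (m<n⇒n≢0 (≤-trans 1≤i i≤k∸y)))

length-filter-oneTo : ∀ k y → length (filter (λ i → i + y ≤? k) (oneTo k)) ≡ k ∸ y
length-filter-oneTo k y = begin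
  length (filter (λ i → i + y ≤? k) (oneTo k))  ≡⟨ cong length (filter-oneTo k y) ⟩
  length (map suc (upTo (k ∸ y)))              ≡⟨ length-map suc (upTo (k ∸ y)) ⟩
  length (upTo (k ∸ y))                        ≡⟨ length-upTo (k ∸ y) ⟩
  k ∸ y                                        ∎
  where open ≡-Reasoning

length-D : ∀ k x → length (D k x) ≡ k ∸ ∣ x ∣
length-D k (ℤ.+ y)  = trans (length-map _ (filter _ (oneTo k))) (length-filter-oneTo k y)
length-D k -[1+ y ] = trans (length-map _ (filter _ (oneTo k))) (length-filter-oneTo k (suc y))

filter-diagonal-cells : ∀ k x → filter (λ c → diagonalOf c ℤ.≟ x) (cells k) ≡ D k x
filter-diagonal-cells k x = strictlySorted-⊆-antisym ≺-irrefl ≺-asym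
  (AllPairs.filter⁺ _ (cells-sorted k)) (AllPairs.map (inj₁ ∘ proj₂) (D-sorted k x)) ⊆-D ⊇-D
  where
  ⊆-D : filter (λ c → diagonalOf c ℤ.≟ x) (cells k) ⊆ D k x
  ⊆-D c∈ with c∈cells , on-x ← ∈-filter⁻ (λ c → diagonalOf c ℤ.≟ x) c∈ = ∈-D⁺ x (∈-cells⁻ c∈cells) on-x
  ⊇-D : D k x ⊆ filter (λ c → diagonalOf c ℤ.≟ x) (cells k)
  ⊇-D c∈ with grid , on-x ← ∈-D⁻ x c∈ = ∈-filter⁺ (λ c → diagonalOf c ℤ.≟ x) (∈-cells⁺ grid) on-x

-- Increasing chains of cells away from the main diagonal

OffDiagonal : ℕ → Cell → Set
OffDiagonal s (i , j) = i + s ≤ j ⊎ j + s ≤ i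

onDiagonal⇒offDiagonal : ∀ {s} x c → s ≤ ∣ x ∣ → OnDiagonal x c → OffDiagonal s c
onDiagonal⇒offDiagonal (ℤ.+ y)  (i , _) s≤y refl = inj₁ (+-monoʳ-≤ i s≤y)
onDiagonal⇒offDiagonal -[1+ y ] (_ , j) s≤y refl = inj₂ (+-monoʳ-≤ j s≤y)

offDiagonal : ∀ {s} c → s ≤ ∣ diagonalOf c ∣ → OffDiagonal s c
offDiagonal c s≤ = onDiagonal⇒offDiagonal (diagonalOf c) c s≤ (onDiagonal-diagonalOf c)

-- i above the main diagonal, i ∸ s at distance ≥ s below it
foldedRow : ℕ → Cell → ℕ
foldedRow s (i , j) = i ∸ (s ⊓ (i ∸ j))

foldedRow-above : ∀ s {i j} → i + s ≤ j → foldedRow s (i , j) ≡ i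
foldedRow-above s {i} i+s≤j rewrite m≤n⇒m∸n≡0 (≤-trans (m≤m+n i s) i+s≤j) | ⊓-zeroʳ s = refl

foldedRow-below : ∀ s {i j} → j + s ≤ i → foldedRow s (i , j) ≡ i ∸ s
foldedRow-below s {i} {j} j+s≤i =
  cong (i ∸_) (m≤n⇒m⊓n≡m (m+n≤o⇒m≤o∸n s (subst (_≤ i) (+-comm j s) j+s≤i)))

foldedRow-bounds : ∀ {k s} c → InGrid k c → OffDiagonal s c → 0 < foldedRow s c × foldedRow s c ≤ k ∸ s
foldedRow-bounds {k} {s} (i , j) ((1≤i , _) , (_ , j≤k)) (inj₁ i+s≤j)
  rewrite foldedRow-above s i+s≤j = 1≤i , m+n≤o⇒m≤o∸n i (≤-trans i+s≤j j≤k)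
foldedRow-bounds {k} {s} (i , j) ((_ , i≤k) , (1≤j , _)) (inj₂ j+s≤i)
  rewrite foldedRow-below s j+s≤i = ≤-trans 1≤j (m+n≤o⇒m≤o∸n j j+s≤i) , ∸-monoˡ-≤ s i≤k

above-then-below : ∀ {s i j i′ j′} → i + s ≤ j → j′ + s ≤ i′ → i + j < i′ + j′ → i + s < i′
above-then-below {s} {i} {j} {i′} {j′} i+s≤j j′+s≤i′ ij<i′j′ = ≰⇒> λ i′≤i+s →
  <⇒≱ ij<i′j′ (begin
    i′ + j′       ≤⟨ +-mono-≤ i′≤i+s (+-cancelʳ-≤ s j′ i (≤-trans j′+s≤i′ i′≤i+s)) ⟩
    (i + s) + i   ≤⟨ +-monoˡ-≤ i i+s≤j ⟩
    j + i         ≡⟨ +-comm j i ⟩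
    i + j         ∎)
  where open ≤-Reasoning

foldedRow-mono : ∀ {s} c c′ → OffDiagonal s c → OffDiagonal s c′ → c ⊏ c′ → foldedRow s c < foldedRow s c′
foldedRow-mono {s} (i , j) (i′ , j′) (inj₁ above) (inj₁ above′) (i<i′ , _)
  rewrite foldedRow-above s above | foldedRow-above s above′ = i<i′
foldedRow-mono {s} (i , j) (i′ , j′) (inj₂ below) (inj₂ below′) (i<i′ , _)
  rewrite foldedRow-below s below | foldedRow-below s below′ = ∸-monoˡ-< i<i′ (≤-trans (m≤n+m s j) below)
foldedRow-mono {s} (i , j) (i′ , j′) (inj₂ below) (inj₁ above′) (i<i′ , _)
  rewrite foldedRow-below s below | foldedRow-above s above′ = ≤-<-trans (m∸n≤m i s) i<i′
foldedRow-mono {s} (i , j) (i′ , j′) (inj₁ above) (inj₂ below′) (_ , ij<i′j′)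
  rewrite foldedRow-above s above | foldedRow-below s below′ =
  m+n≤o⇒m≤o∸n (suc i) (above-then-below above below′ ij<i′j′)

AllPairs-⊏-length≤ : ∀ {k s cs} → AllPairs _⊏_ cs → All (λ c → InGrid k c × OffDiagonal s c) cs → length cs ≤ k ∸ s
AllPairs-⊏-length≤ {k} {s} {cs} increasing cells-ok = begin
  length cs                      ≡⟨ length-map (foldedRow s) cs ⟨
  length (map (foldedRow s) cs)  ≤⟨ AllPairs-<-length≤ folded-increasing folded-bounds ⟩
  k ∸ s                          ∎
  where
  open ≤-Reasoning
  folded-increasing : AllPairs _<_ (map (foldedRow s) cs)
  folded-increasing = AllPairs.map⁺ (AllPairs-restrict
    (λ {c} {c′} (_ , off) (_ , off′) → foldedRow-mono c c′ off off′) cells-ok increasing)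
  folded-bounds : All (λ n → 0 < n × n ≤ k ∸ s) (map (foldedRow s) cs)
  folded-bounds = All.map⁺ (All.map (λ {c} (grid , off) → foldedRow-bounds c grid off) cells-ok)

IncreasingStep : (s : List ℕ) → Rel (Pos s) 0ℓ
IncreasingStep s p q = (p Fin.< q) × (lookup s p < lookup s q)

IncreasingStep-trans : ∀ s → Transitive (IncreasingStep s)
IncreasingStep-trans s (p<q , u<v) (q<r , v<w) = Fin.<-trans p<q q<r , <-trans u<v v<w

lookup-ω : ∀ k p → lookup (ω k) p ≡ row (cellAt k p)
lookup-ω k = lookup-map-cast proj₁ (cells k)

map-cellAt-allFin : ∀ k → map (cellAt k) (allFin (length (ω k))) ≡ cells k
map-cellAt-allFin k = trans (map-tabulate id (cellAt k)) (tabulate-lookup-cast proj₁ (cells k))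

cellAt-inGrid : ∀ k p → InGrid k (cellAt k p)
cellAt-inGrid k p = ∈-cells⁻ (∈-lookup _)

cellAt-≺ : ∀ k {p q} → p Fin.< q → cellAt k p ≺ cellAt k q
cellAt-≺ k {p} {q} p<q =
  AllPairs-lookup (cells-sorted k) (subst₂ _<_ (sym (toℕ-cast _ p)) (sym (toℕ-cast _ q)) p<q)

increasingStep⇒⊏ : ∀ k {p q} → IncreasingStep (ω k) p q → cellAt k p ⊏ cellAt k q
increasingStep⇒⊏ k {p} {q} (p<q , u<v) =
  ≺∧row<⇒⊏ (cellAt-≺ k p<q) (subst₂ _<_ (lookup-ω k p) (lookup-ω k q) u<v)

incSub-offDiagonal-length≤ : ∀ {k s avail qs} → IncSub (ω k) avail qs →
                             (∀ {q} → avail q → OffDiagonal s (cellAt k q)) → length qs ≤ k ∸ s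
incSub-offDiagonal-length≤ {k} {s} {qs = qs} (linked , available) far = begin
  length qs                   ≡⟨ length-map (cellAt k) qs ⟨
  length (map (cellAt k) qs)  ≤⟨ AllPairs-⊏-length≤ increasing cells-ok ⟩
  k ∸ s                       ∎
  where
  open ≤-Reasoning
  increasing = AllPairs.map⁺ (AllPairs.map (increasingStep⇒⊏ k)
                 (Linked.Linked⇒AllPairs (IncreasingStep-trans (ω k)) linked))
  cells-ok = All.map⁺ (All.map (λ {q} a → cellAt-inGrid k q , far a) available)

diagonalPositions : (k : ℕ) → ℤ → List (Pos (ω k))
diagonalPositions k x = filter (λ p → diagonalOf (cellAt k p) ℤ.≟ x) (allFin (length (ω k)))

map-cellAt-diagonalPositions : ∀ k x → map (cellAt k) (diagonalPositions k x) ≡ D k x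
map-cellAt-diagonalPositions k x = begin
  map (cellAt k) (diagonalPositions k x)             ≡⟨ map-filter (cellAt k) on-x? (allFin _) ⟩
  filter on-x? (map (cellAt k) (allFin _))           ≡⟨ cong (filter on-x?) (map-cellAt-allFin k) ⟩
  filter on-x? (cells k)                             ≡⟨ filter-diagonal-cells k x ⟩
  D k x                                              ∎
  where
  open ≡-Reasoning
  on-x? = λ c → diagonalOf c ℤ.≟ x

length-diagonalPositions : ∀ k x → length (diagonalPositions k x) ≡ k ∸ ∣ x ∣
length-diagonalPositions k x = begin
  length (diagonalPositions k x)                   ≡⟨ length-map (cellAt k) (diagonalPositions k x) ⟨
  length (map (cellAt k) (diagonalPositions k x))  ≡⟨ cong length (map-cellAt-diagonalPositions k x) ⟩
  length (D k x)                                   ≡⟨ length-D k x ⟩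
  k ∸ ∣ x ∣                                        ∎
  where open ≡-Reasoning

diagonalPositions-increasing : ∀ k x → Linked (IncreasingStep (ω k)) (diagonalPositions k x)
diagonalPositions-increasing k x =
  Linked.AllPairs⇒Linked (AllPairs.zipWith step (positions-increasing , rows-increasing))
  where
  positions-increasing : AllPairs Fin._<_ (diagonalPositions k x)
  positions-increasing = AllPairs.filter⁺ _ (AllPairs.tabulate⁺-< id)
  rows-increasing : AllPairs (_<_ on (row ∘ cellAt k)) (diagonalPositions k x)
  rows-increasing = AllPairs.map⁻ (subst (AllPairs (_<_ on row)) (sym (map-cellAt-diagonalPositions k x))
                                         (AllPairs.map proj₁ (D-sorted k x)))
  step : ∀ {p q} → p Fin.< q × row (cellAt k p) < row (cellAt k q) → IncreasingStep (ω k) p q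
  step {p} {q} (p<q , row<) = p<q , subst₂ _<_ (sym (lookup-ω k p)) (sym (lookup-ω k q)) row<

-- inverse to m ↦ diagIndex (suc m), which lists the diagonals as 0, 1, -1, 2, -2, …
rank : ℤ → ℕ
rank (ℤ.+ zero)    = 0
rank (ℤ.+ (suc y)) = suc (y * 2)
rank -[1+ y ]      = suc y * 2

diagIndex-even : ∀ n → n % 2 ≡ 0 → diagIndex n ≡ ℤ.+ (n / 2)
diagIndex-even n n%2≡0 with n % 2 | n%2≡0
... | .0 | refl = refl

diagIndex-odd : ∀ n → n % 2 ≡ 1 → diagIndex n ≡ - ℤ.+ (n / 2)
diagIndex-odd n n%2≡1 with n % 2 | n%2≡1
... | .1 | refl = refl

diagIndex-rank : ∀ x → diagIndex (suc (rank x)) ≡ x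
diagIndex-rank (ℤ.+ zero)    = refl
diagIndex-rank (ℤ.+ (suc y)) =
  trans (diagIndex-even (suc y * 2) (m*n%n≡0 (suc y) 2)) (cong ℤ.+_ (m*n/n≡m (suc y) 2))
diagIndex-rank -[1+ y ]      =
  trans (diagIndex-odd (1 + suc y * 2) ([m+kn]%n≡m%n 1 (suc y) 2))
        (cong (λ n → - ℤ.+ n) ([m+n*d]/d≡n {1} {suc y} {2} (s≤s (s≤s z≤n))))

rank-surjective : ∀ m → ∃ λ x → rank x ≡ m
rank-surjective zero = ℤ.+ 0 , refl
rank-surjective (suc m) with rank-surjective m
... | ℤ.+ zero    , refl = ℤ.+ 1 , refl
... | ℤ.+ (suc y) , refl = -[1+ y ] , refl
... | -[1+ y ]    , refl = ℤ.+ (suc (suc y)) , refl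

rank-diagIndex : ∀ m → rank (diagIndex (suc m)) ≡ m
rank-diagIndex m with x , refl ← rank-surjective m = cong rank (diagIndex-rank x)

∣∣≡⌈rank/2⌉ : ∀ x → ∣ x ∣ ≡ ⌈ rank x /2⌉
∣∣≡⌈rank/2⌉ (ℤ.+ zero)    = refl
∣∣≡⌈rank/2⌉ (ℤ.+ (suc y)) = cong suc (sym (⌊n*2/2⌋≡n y))
∣∣≡⌈rank/2⌉ -[1+ y ]      = cong suc (sym (⌈n*2/2⌉≡n y))

∣diagIndex∣≡⌈m/2⌉ : ∀ m → ∣ diagIndex (suc m) ∣ ≡ ⌈ m /2⌉
∣diagIndex∣≡⌈m/2⌉ m = trans (∣∣≡⌈rank/2⌉ (diagIndex (suc m))) (cong ⌈_/2⌉ (rank-diagIndex m))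

∣diagIndex∣-mono : ∀ {m} x → m ≤ rank x → ∣ diagIndex (suc m) ∣ ≤ ∣ x ∣
∣diagIndex∣-mono {m} x m≤rank =
  subst₂ _≤_ (sym (∣diagIndex∣≡⌈m/2⌉ m)) (sym (∣∣≡⌈rank/2⌉ x)) (⌈n/2⌉-mono m≤rank)

-- The greedy run

-- chosen k m is the paper's A_{m+1}
chosen : (k m : ℕ) → List (Pos (ω k))
chosen k m = diagonalPositions k (diagIndex (suc m))

rankAt : (k : ℕ) → Pos (ω k) → ℕ
rankAt k q = rank (diagonalOf (cellAt k q))

∈-chosen⇔ : ∀ {k m q} → q ∈ chosen k m ⇔ rankAt k q ≡ m
∈-chosen⇔ {k} {m} {q} = mk⇔
  (λ q∈ → trans (cong rank (proj₂ (∈-filter⁻ on? {xs = allFin _} q∈))) (rank-diagIndex m))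
  (λ rank≡m → ∈-filter⁺ on? (∈-allFin q)
     (trans (sym (diagIndex-rank (diagonalOf (cellAt k q)))) (cong (diagIndex ∘ suc) rank≡m)))
  where on? = λ p → diagonalOf (cellAt k p) ℤ.≟ diagIndex (suc m)

UsedBelow : (k m : ℕ) → List (Pos (ω k)) → Set
UsedBelow k m used = ∀ q → q ∈ used ⇔ rankAt k q < m

UsedBelow-[] : ∀ k → UsedBelow k 0 []
UsedBelow-[] k q = mk⇔ (λ ()) (λ ())

UsedBelow-step : ∀ {k m used} → UsedBelow k m used → UsedBelow k (suc m) (used ++ chosen k m)
UsedBelow-step {k} {m} {used} usedBelow q = mk⇔ rank<1+m ∈-used++chosen
  where
  open Equivalence
  rank<1+m : q ∈ used ++ chosen k m → rankAt k q < suc m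
  rank<1+m q∈ with ∈-++⁻ used q∈
  ... | inj₁ q∈used   = m<n⇒m<1+n (to (usedBelow q) q∈used)
  ... | inj₂ q∈chosen = ≤-reflexive (cong suc (to (∈-chosen⇔ {k} {m}) q∈chosen))
  ∈-used++chosen : rankAt k q < suc m → q ∈ used ++ chosen k m
  ∈-used++chosen rank≤m with m≤n⇒m<n∨m≡n (s≤s⁻¹ rank≤m)
  ... | inj₁ rank<m = ∈-++⁺ˡ (from (usedBelow q) rank<m)
  ... | inj₂ rank≡m = ∈-++⁺ʳ used (from (∈-chosen⇔ {k} {m}) rank≡m)

chosen-longest : ∀ {k m used} → UsedBelow k m used → LongestIncSub (ω k) (_∉ used) (chosen k m)
chosen-longest {k} {m} {used} usedBelow =
  (diagonalPositions-increasing k (diagIndex (suc m)) , unused) , longest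
  where
  open Equivalence
  unused : All (_∉ used) (chosen k m)
  unused = All.tabulate λ {q} q∈chosen q∈used →
    <-irrefl (to (∈-chosen⇔ {k} {m}) q∈chosen) (to (usedBelow q) q∈used)
  far : ∀ {q} → q ∉ used → OffDiagonal ∣ diagIndex (suc m) ∣ (cellAt k q)
  far {q} q∉used = offDiagonal (cellAt k q)
    (∣diagIndex∣-mono (diagonalOf (cellAt k q)) (≮⇒≥ (q∉used ∘ from (usedBelow q))))
  longest : ∀ qs → IncSub (ω k) (_∉ used) qs → length qs ≤ length (chosen k m)
  longest qs incSub = ≤-trans (incSub-offDiagonal-length≤ {k} incSub far)
                              (≤-reflexive (sym (length-diagonalPositions k (diagIndex (suc m)))))

-- stated for any f ≗ (_+ m): applyUpTo recurses on f ∘ suc, which is not definitionally _+ suc m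
greedyFrom-chosen : ∀ {k m used} n (f : ℕ → ℕ) → (∀ r → f r ≡ r + m) → UsedBelow k m used →
                    GreedyFrom (ω k) used (applyUpTo (chosen k ∘ f) n)
greedyFrom-chosen zero    f f≗ usedBelow = tt
greedyFrom-chosen {k} {m} (suc n) f f≗ usedBelow rewrite f≗ 0 =
  chosen-longest {k} usedBelow ,
  greedyFrom-chosen {k} n (f ∘ suc) (λ r → trans (f≗ (suc r)) (sym (+-suc r m)))
                    (UsedBelow-step {k} usedBelow)

lookup-chosen : ∀ k m (m<len : m < length (applyUpTo (chosen k) k)) →
                map (cellAt k) (lookup (applyUpTo (chosen k) k) (fromℕ< m<len)) ≡ D k (diagIndex (suc m))
lookup-chosen k m m<len = begin
  map (cellAt k) (lookup (applyUpTo (chosen k) k) (fromℕ< m<len))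
    ≡⟨ cong (map (cellAt k)) (lookup-applyUpTo (chosen k) k (fromℕ< m<len)) ⟩
  map (cellAt k) (chosen k (toℕ (fromℕ< m<len)))
    ≡⟨ cong (map (cellAt k) ∘ chosen k) (toℕ-fromℕ< m<len) ⟩
  map (cellAt k) (chosen k m)
    ≡⟨ map-cellAt-diagonalPositions k (diagIndex (suc m)) ⟩
  D k (diagIndex (suc m)) ∎
  where open ≡-Reasoning

sum-length-chosen : ∀ k → sum (map length (applyUpTo (chosen k) k)) ≡ ceil3k²/4 k
sum-length-chosen k = +-cancelʳ-≡ (⌊ k /2⌋ * ⌈ k /2⌉) _ _ (begin
  sum (map length (applyUpTo (chosen k) k)) + ⌊ k /2⌋ * ⌈ k /2⌉
    ≡⟨ cong₂ _+_ (cong sum (map-applyUpTo (chosen k) length k)) (sym (sum-applyUpTo-⌈/2⌉ k)) ⟩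
  sum (applyUpTo (length ∘ chosen k) k) + sum (applyUpTo ⌈_/2⌉ k)
    ≡⟨ sum-applyUpTo-complement k _ _ length+⌈/2⌉ ⟩
  k * k
    ≡⟨ ceil3k²/4+⌊k/2⌋*⌈k/2⌉≡k*k k ⟨
  ceil3k²/4 k + ⌊ k /2⌋ * ⌈ k /2⌉ ∎)
  where
  open ≡-Reasoning
  length+⌈/2⌉ : ∀ r → r < k → length (chosen k r) + ⌈ r /2⌉ ≡ k
  length+⌈/2⌉ r r<k = begin
    length (chosen k r) + ⌈ r /2⌉          ≡⟨ cong (_+ ⌈ r /2⌉) (length-diagonalPositions k (diagIndex (suc r))) ⟩
    (k ∸ ∣ diagIndex (suc r) ∣) + ⌈ r /2⌉  ≡⟨ cong (λ n → k ∸ n + ⌈ r /2⌉) (∣diagIndex∣≡⌈m/2⌉ r) ⟩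
    (k ∸ ⌈ r /2⌉) + ⌈ r /2⌉                ≡⟨ m∸n+n≡m (≤-trans (⌈n/2⌉≤n r) (<⇒≤ r<k)) ⟩
    k                                      ∎

lemma3p3 : (k : ℕ) → 1 ≤ k →
    Σ (List (List (Pos (ω k)))) (λ As →
      GreedyRun (ω k) k As
      × ((m : ℕ) (m<len : m < length As) →
           map (cellAt k) (lookup As (fromℕ< m<len)) ≡ D k (diagIndex (suc m)))
      × (sum (map length As) ≡ ceil3k²/4 k))
lemma3p3 k _ =
  applyUpTo (chosen k) k ,
  (length-applyUpTo (chosen k) k , greedyFrom-chosen {k} k id (λ r → sym (+-identityʳ r)) (UsedBelow-[] k)) ,
  lookup-chosen k ,
  sum-length-chosen k
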